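{- Let $N\ge1$, $f:\mathbb{N}^N\to\mathbb{N}$, $p$ a prime, $n$ a nonnegative integer, and let $\boldsymbol{\ell}\in\mathbb{N}^N$ be such that $\boldsymbol{\ell}\neq p\mathbf{m}$ for every $\mathbf{m}\in\mathbb{N}^N$. Define $g:\mathbb{N}^N\to\mathbb{N}$ by $g(\mathbf{x})=\binom{p}{p\mathbf{x}}_f$. Then $$\binom{np}{\boldsymbol{\ell}}_f\equiv n\cdot\sum_{\mathbf{k}}\binom{p}{\mathbf{k}}_f\binom{n-1}{\mathbf{x}}_g\pmod{p^2},$$ where the sum is over all $\mathbf{k}\in S(\boldsymbol{\ell})$ such that $\mathbf{k}$ is not of the form $p\mathbf{r}$ with $\mathbf{r}\in\mathbb{N}^N$ and $\boldsymbol{\ell}-\mathbf{k}=p\mathbf{x}$ for some $\mathbf{x}\in\mathbb{N}^N$ (this $\mathbf{x}$ being the one appearing in the summand). For $n=0$ the right-hand side is $0$.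
   Context: $\mathbb{N}=\{0,1,2,\dots\}$. $S(\boldsymbol{\ell})=\{\mathbf{s}\in\mathbb{N}^N:\mathbf{s}\neq\mathbf{0},\ 0\le s_j\le\ell_j \text{ for all } j\}$. For $h:\mathbb{N}^N\to\mathbb{N}$, $k\ge0$ and $\boldsymbol{\ell}\in\mathbb{N}^N$, $\binom{k}{\boldsymbol{\ell}}_h=\sum h(\mathbf{m}_1)\cdots h(\mathbf{m}_k)$ over all ordered $k$-tuples of vectors $\mathbf{m}_j\in\mathbb{N}^N$ with $\mathbf{m}_1+\cdots+\mathbf{m}_k=\boldsymbol{\ell}$ (for $k=0$: $1$ if $\boldsymbol{\ell}=\mathbf{0}$, else $0$). -}

module Defs where

open import Data.Nat using (ℕ; zero; suc; _+_; _*_)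
open import Data.Nat.Properties using (_≟_)
open import Data.Nat.Divisibility using (_∣_; _∣?_)
open import Data.List using (List; []; _∷_; map; concatMap; upTo; foldr)
open import Data.Vec using (Vec; []; _∷_; zipWith; replicate)
import Data.Vec as V
open import Data.Vec.Properties using (≡-dec)
open import Data.Vec.Relation.Unary.All using (All; all?)
open import Data.Bool using (Bool; if_then_else_)
open import Relation.Nullary using (Dec; ¬?; ⌊_⌋)
open import Relation.Binary.PropositionalEquality using (_≡_)

NVec : ℕ → Set
NVec N = Vec ℕ N

_⊕_ : ∀ {N} → NVec N → NVec N → NVec N
_⊕_ = zipWith _+_

𝟎 : ∀ {N} → NVec N
𝟎 = replicate _ 0

_·_ : ∀ {N} → ℕ → NVec N → NVec N
p · m = V.map (p *_) m

_≟ᵥ_ : ∀ {N} (u v : NVec N) → Dec (u ≡ v)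
_≟ᵥ_ = ≡-dec _≟_

box : ∀ {N} → NVec N → List (NVec N)
box [] = [] ∷ []
box (l ∷ ls) = concatMap (λ a → map (a ∷_) (box ls)) (upTo (suc l))

tuples : ∀ {A : Set} (k : ℕ) → List A → List (Vec A k)
tuples zero xs = [] ∷ []
tuples (suc k) xs = concatMap (λ a → map (a ∷_) (tuples k xs)) xs

Σ[_]_ : ∀ {A : Set} → List A → (A → ℕ) → ℕ
Σ[ xs ] f = foldr (λ a acc → f a + acc) 0 xs

vsum : ∀ {N k} → Vec (NVec N) k → NVec N
vsum [] = 𝟎
vsum (m ∷ ms) = m ⊕ vsum ms

prodH : ∀ {N k} → (NVec N → ℕ) → Vec (NVec N) k → ℕ
prodH h [] = 1
prodH h (m ∷ ms) = h m * prodH h ms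

-- binom k ℓ h = Σ h(m₁)⋯h(m_k) over ordered k-tuples (m₁,…,m_k) of vectors
-- in ℕ^N with m₁+⋯+m_k = ℓ.  Every such mⱼ satisfies mⱼ ≤ ℓ componentwise,
-- so it suffices to range over tuples from box ℓ (for k = 0 this gives
-- 1 if ℓ = 0 and 0 otherwise).
binom : ∀ {N} → (h : NVec N → ℕ) → ℕ → NVec N → ℕ
binom h k ℓ = Σ[ tuples k (box ℓ) ] λ ms →
  if ⌊ vsum ms ≟ᵥ ℓ ⌋ then prodH h ms else 0

-- "k is of the form p·r": every component divisible by p
DivBy : ∀ {N} → ℕ → NVec N → Set
DivBy p k = All (p ∣_) k

-- Pairs (k , x) are ranged over box ℓ × box ℓ (x ≤ ℓ automatically as p ≥ 1),
-- and the condition ℓ - k = p·x is written as k + p·x = ℓ.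
rhsSum : ∀ {N} → (f : NVec N → ℕ) → (p m : ℕ) → NVec N → ℕ
rhsSum f p m ℓ =
  Σ[ box ℓ ] λ k → Σ[ box ℓ ] λ x →
    if ⌊ ¬? (k ≟ᵥ 𝟎) ⌋ then
      (if ⌊ ¬? (all? (p ∣?_) k) ⌋ then
        (if ⌊ (k ⊕ (p · x)) ≟ᵥ ℓ ⌋ then
           binom f p k * binom (λ y → binom f p (p · y)) m x
         else 0)
       else 0)
    else 0

-- binom f (n p) is the n-th convolution power of F = binom f p.  Split F = F₀ + Fₒ with
-- F₀ supported on the lattice pℕ^N and Fₒ off it.  Every value of Fₒ is divisible by p
-- (uⱼ · binom f p u = p · (…) by a Leibniz rule, and some uⱼ is prime to p), so modulo p²
-- the binomial expansion of (F₀ + Fₒ)^n reduces to F₀^n + n · Fₒ ⋆ F₀^(n-1).  Since F₀ is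
-- the dilation by p of g, its powers are dilations of the powers of g: F₀^n vanishes at
-- ℓ ∉ pℕ^N, and Fₒ ⋆ F₀^(n-1) evaluated at ℓ is the sum on the right-hand side.

module Submission where

open import Defs
open import Data.Nat using (ℕ; _≤_; _*_; _∸_)
open import Data.Nat.Primality using (Prime)
open import Relation.Binary.PropositionalEquality using (_≢_)

open import Level using (Level)
open import Data.Nat using (zero; suc; _+_; _<_; z≤n; s≤s; NonZero; _≟_; _≤?_)
open import Data.Nat.Properties
  using ( ≤-refl; ≤-trans; ≤-pred; <⇒≱; m≤m+n; m≤n*m; suc-injective; m+n∸m≡n
        ; +-identityʳ; +-assoc; +-comm; *-comm; *-zeroʳ; *-identityʳ; *-identityˡ
        ; *-distribˡ-+; *-cancelˡ-≡ )
open import Data.Nat.Divisibility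
  using (divides; _∣?_; ∣m∣n⇒∣m+n; ∣m⇒∣m*n; ∣n⇒∣m*n; m∣m*n; *-pres-∣)
  renaming (_∣_ to _∣ₙ_; _∣0 to _∣ₙ0)
open import Data.Nat.Primality using (euclidsLemma; prime⇒nonZero)
open import Data.Nat.Tactic.RingSolver using (solve-∀)
open import Data.Fin using (Fin; zero; suc)
open import Data.Vec using (Vec; []; _∷_; lookup; head; tail)
open import Data.Vec.Properties using (lookup-zipWith)
open import Data.Vec.Relation.Binary.Pointwise.Inductive as Pw using (Pointwise; []; _∷_)
open import Data.Vec.Relation.Unary.All as All using (All; []; _∷_; all?)
open import Data.List using (List; []; _∷_; map; concatMap; upTo; applyUpTo; _++_)
open import Data.Bool using (if_then_else_)
open import Data.Product using (∃; _×_; _,_; proj₁; proj₂)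
open import Data.Sum using (inj₁; inj₂)
open import Data.Empty using (⊥-elim)
open import Relation.Nullary using (Dec; yes; no; ¬_; ⌊_⌋; ¬?)
open import Relation.Binary.PropositionalEquality
  using (_≡_; refl; sym; trans; cong; cong₂; subst; subst₂; _≗_; module ≡-Reasoning)

private variable
  a : Level
  A : Set
  P Q : Set a
  K N : ℕ

ind : Dec P → ℕ → ℕ
ind d x = if ⌊ d ⌋ then x else 0

ind-yes : (d : Dec P) {x : ℕ} → P → ind d x ≡ x
ind-yes (yes _) _ = refl
ind-yes (no ¬p) p = ⊥-elim (¬p p)

ind-no : (d : Dec P) {x : ℕ} → ¬ P → ind d x ≡ 0
ind-no (yes p) ¬p = ⊥-elim (¬p p)
ind-no (no _) _ = refl

ind-zero : (d : Dec P) → ind d 0 ≡ 0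
ind-zero (yes _) = refl
ind-zero (no _) = refl

ind-⇔ : (d : Dec P) (e : Dec Q) {x : ℕ} → (P → Q) → (Q → P) → ind d x ≡ ind e x
ind-⇔ (yes p) (yes q) _ _ = refl
ind-⇔ (yes p) (no ¬q) f _ = ⊥-elim (¬q (f p))
ind-⇔ (no ¬p) (yes q) _ g = ⊥-elim (¬p (g q))
ind-⇔ (no _) (no _) _ _ = refl

ind-cong : (d : Dec P) {x y : ℕ} → (P → x ≡ y) → ind d x ≡ ind d y
ind-cong (yes p) f = f p
ind-cong (no _) f = refl

ind-comm : (d : Dec P) (e : Dec Q) {x : ℕ} → ind d (ind e x) ≡ ind e (ind d x)
ind-comm (yes _) (yes _) = refl
ind-comm (yes _) (no _) = refl
ind-comm (no _) (yes _) = refl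
ind-comm (no _) (no _) = refl

ind-*ʳ : (d : Dec P) (x y : ℕ) → x * ind d y ≡ ind d (x * y)
ind-*ʳ (yes _) x y = refl
ind-*ʳ (no _) x y = *-zeroʳ x

ind-+ : (d : Dec P) (x y : ℕ) → ind d (x + y) ≡ ind d x + ind d y
ind-+ (yes _) x y = refl
ind-+ (no _) x y = refl

ind-∣ : ∀ {m} (d : Dec P) {x : ℕ} → (P → m ∣ₙ x) → m ∣ₙ ind d x
ind-∣ (yes p) f = f p
ind-∣ {m = m} (no _) f = m ∣ₙ0

infix 4 _≤ᵥ_
_≤ᵥ_ : NVec N → NVec N → Set
_≤ᵥ_ = Pointwise _≤_

_≤ᵥ?_ : (x y : NVec N) → Dec (x ≤ᵥ y)
_≤ᵥ?_ = Pw.decidable _≤?_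

≤ᵥ-refl : {x : NVec N} → x ≤ᵥ x
≤ᵥ-refl = Pw.refl ≤-refl

≤ᵥ-trans : {x y z : NVec N} → x ≤ᵥ y → y ≤ᵥ z → x ≤ᵥ z
≤ᵥ-trans = Pw.trans ≤-trans

⊕-comm : (x y : NVec N) → x ⊕ y ≡ y ⊕ x
⊕-comm [] [] = refl
⊕-comm (a ∷ x) (b ∷ y) = cong₂ _∷_ (+-comm a b) (⊕-comm x y)

⊕-assoc : (x y z : NVec N) → (x ⊕ y) ⊕ z ≡ x ⊕ (y ⊕ z)
⊕-assoc [] [] [] = refl
⊕-assoc (a ∷ x) (b ∷ y) (c ∷ z) = cong₂ _∷_ (+-assoc a b c) (⊕-assoc x y z)

⊕-identityʳ : (x : NVec N) → x ⊕ 𝟎 ≡ x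
⊕-identityʳ [] = refl
⊕-identityʳ (a ∷ x) = cong₂ _∷_ (+-identityʳ a) (⊕-identityʳ x)

𝟎≤ᵥ : (x : NVec N) → 𝟎 ≤ᵥ x
𝟎≤ᵥ [] = []
𝟎≤ᵥ (a ∷ x) = z≤n ∷ 𝟎≤ᵥ x

x≤ᵥx⊕y : (x y : NVec N) → x ≤ᵥ x ⊕ y
x≤ᵥx⊕y [] [] = []
x≤ᵥx⊕y (a ∷ x) (b ∷ y) = m≤m+n a b ∷ x≤ᵥx⊕y x y

⊕≡⇒≤ᵥˡ : {x y u : NVec N} → x ⊕ y ≡ u → x ≤ᵥ u
⊕≡⇒≤ᵥˡ {x = x} {y} refl = x≤ᵥx⊕y x y

⊕≡⇒≤ᵥʳ : {x y u : NVec N} → x ⊕ y ≡ u → y ≤ᵥ u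
⊕≡⇒≤ᵥʳ {x = x} {y} e = ⊕≡⇒≤ᵥˡ (trans (⊕-comm y x) e)

·-distrib-⊕ : (p : ℕ) (x y : NVec N) → p · (x ⊕ y) ≡ (p · x) ⊕ (p · y)
·-distrib-⊕ p [] [] = refl
·-distrib-⊕ p (a ∷ x) (b ∷ y) = cong₂ _∷_ (*-distribˡ-+ p a b) (·-distrib-⊕ p x y)

·-zeroʳ : (p : ℕ) → p · 𝟎 {N} ≡ 𝟎
·-zeroʳ {zero} p = refl
·-zeroʳ {suc N} p = cong₂ _∷_ (*-zeroʳ p) (·-zeroʳ p)

·-cancelˡ : (p : ℕ) .{{_ : NonZero p}} {x y : NVec N} → p · x ≡ p · y → x ≡ y
·-cancelˡ p {[]} {[]} e = refl
·-cancelˡ p {a ∷ x} {b ∷ y} e =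
  cong₂ _∷_ (*-cancelˡ-≡ a b p (cong head e)) (·-cancelˡ p (cong tail e))

x≤ᵥp·x : (p : ℕ) .{{_ : NonZero p}} (x : NVec N) → x ≤ᵥ p · x
x≤ᵥp·x p [] = []
x≤ᵥp·x p (a ∷ x) = m≤n*m a p ∷ x≤ᵥp·x p x

DivBy-· : (p : ℕ) (x : NVec N) → DivBy p (p · x)
DivBy-· p [] = []
DivBy-· p (a ∷ x) = m∣m*n a ∷ DivBy-· p x

DivBy⇒· : (p : ℕ) {u : NVec N} → DivBy p u → ∃ λ y → u ≡ p · y
DivBy⇒· p [] = [] , refl
DivBy⇒· p (divides q e ∷ ds) with DivBy⇒· p ds
... | y , refl = q ∷ y , cong (_∷ _) (trans e (*-comm q p))

¬DivBy⇒coordinate : (p : ℕ) {u : NVec N} → ¬ DivBy p u → ∃ λ j → ¬ p ∣ₙ lookup u j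
¬DivBy⇒coordinate p {[]} ¬d = ⊥-elim (¬d [])
¬DivBy⇒coordinate p {a ∷ u} ¬d with p ∣? a
... | no p∤a = zero , p∤a
... | yes p∣a with ¬DivBy⇒coordinate p (λ d → ¬d (p∣a ∷ d))
...   | j , p∤uⱼ = suc j , p∤uⱼ

sumTo : ℕ → (ℕ → ℕ) → ℕ
sumTo zero ψ = 0
sumTo (suc n) ψ = ψ 0 + sumTo n (λ i → ψ (suc i))

sumTo-cong : ∀ n {ψ ψ′ : ℕ → ℕ} → (∀ i → i < n → ψ i ≡ ψ′ i) → sumTo n ψ ≡ sumTo n ψ′
sumTo-cong zero f = refl
sumTo-cong (suc n) f = cong₂ _+_ (f 0 (s≤s z≤n)) (sumTo-cong n (λ i i<n → f (suc i) (s≤s i<n)))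

sumTo-zero : ∀ n {ψ : ℕ → ℕ} → (∀ i → i < n → ψ i ≡ 0) → sumTo n ψ ≡ 0
sumTo-zero zero f = refl
sumTo-zero (suc n) f = cong₂ _+_ (f 0 (s≤s z≤n)) (sumTo-zero n (λ i i<n → f (suc i) (s≤s i<n)))

sumTo-+ : ∀ n (φ ψ : ℕ → ℕ) → sumTo n (λ i → φ i + ψ i) ≡ sumTo n φ + sumTo n ψ
sumTo-+ zero φ ψ = refl
sumTo-+ (suc n) φ ψ =
  trans (cong (φ 0 + ψ 0 +_) (sumTo-+ n _ _)) (interchange (φ 0) (ψ 0) _ _)
  where
  interchange : ∀ a b c d → (a + b) + (c + d) ≡ (a + c) + (b + d)
  interchange = solve-∀

sumTo-* : ∀ n c (φ : ℕ → ℕ) → sumTo n (λ i → c * φ i) ≡ c * sumTo n φ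
sumTo-* zero c φ = sym (*-zeroʳ c)
sumTo-* (suc n) c φ = trans (cong (c * φ 0 +_) (sumTo-* n c _)) (sym (*-distribˡ-+ c (φ 0) _))

sumTo-∣ : ∀ n {m} {ψ : ℕ → ℕ} → (∀ i → m ∣ₙ ψ i) → m ∣ₙ sumTo n ψ
sumTo-∣ zero {m} f = m ∣ₙ0
sumTo-∣ (suc n) f = ∣m∣n⇒∣m+n (f 0) (sumTo-∣ n (λ i → f (suc i)))

sumTo-extend : ∀ w b {ψ : ℕ → ℕ} → w ≤ b → (∀ i → w < i → ψ i ≡ 0) →
  sumTo (suc w) ψ ≡ sumTo (suc b) ψ
sumTo-extend zero b {ψ} _ f = cong (ψ 0 +_) (sym (sumTo-zero b (λ i _ → f (suc i) (s≤s z≤n))))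
sumTo-extend (suc w) (suc b) {ψ} (s≤s w≤b) f =
  cong (ψ 0 +_) (sumTo-extend w b w≤b (λ i w<i → f (suc i) (s≤s w<i)))

sumTo-δ : ∀ n c (ψ : ℕ → ℕ) → c < n → sumTo n (λ i → ind (c ≟ i) (ψ i)) ≡ ψ c
sumTo-δ (suc n) zero ψ _ = trans (cong (ψ 0 +_) (sumTo-zero n (λ _ _ → refl))) (+-identityʳ _)
sumTo-δ (suc n) (suc c) ψ (s≤s c<n) =
  trans (sumTo-cong n (λ i _ → ind-⇔ (suc c ≟ suc i) (c ≟ i) suc-injective (cong suc)))
        (sumTo-δ n c (λ i → ψ (suc i)) c<n)

sumBox : NVec N → (NVec N → ℕ) → ℕ
sumBox [] φ = φ []
sumBox (b ∷ B) φ = sumTo (suc b) (λ i → sumBox B (λ x → φ (i ∷ x)))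

sumBox-cong : (B : NVec N) {φ ψ : NVec N → ℕ} → (∀ x → x ≤ᵥ B → φ x ≡ ψ x) →
  sumBox B φ ≡ sumBox B ψ
sumBox-cong [] f = f [] []
sumBox-cong (b ∷ B) f =
  sumTo-cong (suc b) (λ i i≤b → sumBox-cong B (λ x x≤B → f (i ∷ x) (≤-pred i≤b ∷ x≤B)))

sumBox-zero : (B : NVec N) {φ : NVec N → ℕ} → (∀ x → x ≤ᵥ B → φ x ≡ 0) → sumBox B φ ≡ 0
sumBox-zero [] f = f [] []
sumBox-zero (b ∷ B) f =
  sumTo-zero (suc b) (λ i i≤b → sumBox-zero B (λ x x≤B → f (i ∷ x) (≤-pred i≤b ∷ x≤B)))

sumBox-+ : (B : NVec N) (φ ψ : NVec N → ℕ) →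
  sumBox B (λ x → φ x + ψ x) ≡ sumBox B φ + sumBox B ψ
sumBox-+ [] φ ψ = refl
sumBox-+ (b ∷ B) φ ψ =
  trans (sumTo-cong (suc b) (λ i _ → sumBox-+ B (λ x → φ (i ∷ x)) (λ x → ψ (i ∷ x))))
        (sumTo-+ (suc b) (λ i → sumBox B (λ x → φ (i ∷ x)))
                         (λ i → sumBox B (λ x → ψ (i ∷ x))))

sumBox-* : (B : NVec N) (c : ℕ) (φ : NVec N → ℕ) → sumBox B (λ x → c * φ x) ≡ c * sumBox B φ
sumBox-* [] c φ = refl
sumBox-* (b ∷ B) c φ =
  trans (sumTo-cong (suc b) (λ i _ → sumBox-* B c (λ x → φ (i ∷ x))))
        (sumTo-* (suc b) c (λ i → sumBox B (λ x → φ (i ∷ x))))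

sumBox-∣ : (B : NVec N) {m : ℕ} {φ : NVec N → ℕ} → (∀ x → m ∣ₙ φ x) → m ∣ₙ sumBox B φ
sumBox-∣ [] f = f []
sumBox-∣ (b ∷ B) f = sumTo-∣ (suc b) (λ i → sumBox-∣ B (λ x → f (i ∷ x)))

sumBox-ind : (B : NVec N) (d : Dec P) (φ : NVec N → ℕ) →
  ind d (sumBox B φ) ≡ sumBox B (λ x → ind d (φ x))
sumBox-ind B (yes _) φ = refl
sumBox-ind B (no _) φ = sym (sumBox-zero B (λ _ _ → refl))

sumTo-sumBox : ∀ n (C : NVec K) (φ : ℕ → NVec K → ℕ) →
  sumTo n (λ i → sumBox C (φ i)) ≡ sumBox C (λ c → sumTo n (λ i → φ i c))
sumTo-sumBox zero C φ = sym (sumBox-zero C (λ _ _ → refl))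
sumTo-sumBox (suc n) C φ =
  trans (cong (sumBox C (φ 0) +_) (sumTo-sumBox n C (λ i → φ (suc i)))) (sym (sumBox-+ C _ _))

sumBox-comm : (B : NVec N) (C : NVec K) (φ : NVec N → NVec K → ℕ) →
  sumBox B (λ x → sumBox C (φ x)) ≡ sumBox C (λ c → sumBox B (λ x → φ x c))
sumBox-comm [] C φ = refl
sumBox-comm (b ∷ B) C φ =
  trans (sumTo-cong (suc b) (λ i _ → sumBox-comm B C (λ x → φ (i ∷ x))))
        (sumTo-sumBox (suc b) C (λ i c → sumBox B (λ x → φ (i ∷ x) c)))

sumBox-extend : (w B : NVec N) {φ : NVec N → ℕ} → w ≤ᵥ B → (∀ x → ¬ x ≤ᵥ w → φ x ≡ 0) →
  sumBox w φ ≡ sumBox B φ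
sumBox-extend [] [] _ _ = refl
sumBox-extend (w ∷ ws) (b ∷ bs) (w≤b ∷ ws≤bs) f =
  trans (sumTo-cong (suc w) (λ i _ → sumBox-extend ws bs ws≤bs
            (λ x x≰ws → f (i ∷ x) (λ i∷x≤ → x≰ws (Pw.tail i∷x≤)))))
        (sumTo-extend w b w≤b (λ i w<i → sumBox-zero bs (λ x _ → f (i ∷ x)
            (λ i∷x≤ → <⇒≱ w<i (Pw.head i∷x≤)))))

ind-≟ᵥ-∷ : (c i : ℕ) (cs t : NVec N) {X : ℕ} →
  ind ((c ∷ cs) ≟ᵥ (i ∷ t)) X ≡ ind (c ≟ i) (ind (cs ≟ᵥ t) X)
ind-≟ᵥ-∷ c i cs t with c ≟ i | cs ≟ᵥ t | (c ∷ cs) ≟ᵥ (i ∷ t)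
... | yes refl | yes refl | yes _ = refl
... | yes refl | yes refl | no ne = ⊥-elim (ne refl)
... | no ne | _ | yes refl = ⊥-elim (ne refl)
... | yes _ | no ne | yes refl = ⊥-elim (ne refl)
... | no _ | _ | no _ = refl
... | yes _ | no _ | no _ = refl

sumBox-δ : (B c : NVec N) (φ : NVec N → ℕ) → c ≤ᵥ B →
  sumBox B (λ x → ind (c ≟ᵥ x) (φ x)) ≡ φ c
sumBox-δ [] [] φ _ = refl
sumBox-δ (b ∷ B) (c ∷ cs) φ (c≤b ∷ cs≤B) = begin
  sumTo (suc b) (λ i → sumBox B (λ t → ind ((c ∷ cs) ≟ᵥ (i ∷ t)) (φ (i ∷ t))))
    ≡⟨ sumTo-cong (suc b) (λ i _ → trans (sumBox-cong B (λ t _ → ind-≟ᵥ-∷ c i cs t))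
                                         (sym (sumBox-ind B (c ≟ i) (λ t → ind (cs ≟ᵥ t) (φ (i ∷ t)))))) ⟩
  sumTo (suc b) (λ i → ind (c ≟ i) (sumBox B (λ t → ind (cs ≟ᵥ t) (φ (i ∷ t)))))
    ≡⟨ sumTo-δ (suc b) c (λ i → sumBox B (λ t → ind (cs ≟ᵥ t) (φ (i ∷ t)))) (s≤s c≤b) ⟩
  sumBox B (λ t → ind (cs ≟ᵥ t) (φ (c ∷ t)))
    ≡⟨ sumBox-δ B cs (λ t → φ (c ∷ t)) cs≤B ⟩
  φ (c ∷ cs) ∎
  where open ≡-Reasoning

sumBox-δ′ : (B c : NVec N) (φ : NVec N → ℕ) → (¬ c ≤ᵥ B → φ c ≡ 0) →
  sumBox B (λ x → ind (c ≟ᵥ x) (φ x)) ≡ φ c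
sumBox-δ′ B c φ f with c ≤ᵥ? B
... | yes c≤B = sumBox-δ B c φ c≤B
... | no c≰B = trans (sumBox-zero B (λ x x≤B → ind-no (c ≟ᵥ x) λ { refl → c≰B x≤B }))
                     (sym (f c≰B))

sumBox-substitute : (u w : NVec N) {Q : NVec N → Set} (Q? : ∀ v → Dec (Q v)) {W : ℕ} →
  (Q w → w ≤ᵥ u) → sumBox u (λ v → ind (Q? v) (ind (w ≟ᵥ v) W)) ≡ ind (Q? w) W
sumBox-substitute u w Q? {W} w≤u =
  trans (sumBox-cong u (λ v _ → shift v))
        (sumBox-δ′ u w (λ _ → ind (Q? w) W) (λ w≰u → ind-no (Q? w) (λ q → w≰u (w≤u q))))
  where
  shift : ∀ v → ind (Q? v) (ind (w ≟ᵥ v) W) ≡ ind (w ≟ᵥ v) (ind (Q? w) W)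
  shift v with w ≟ᵥ v
  ... | yes refl = refl
  ... | no _ = ind-zero (Q? v)

Σ-cong : (xs : List A) {φ ψ : A → ℕ} → (∀ x → φ x ≡ ψ x) → Σ[ xs ] φ ≡ Σ[ xs ] ψ
Σ-cong [] f = refl
Σ-cong (x ∷ xs) f = cong₂ _+_ (f x) (Σ-cong xs f)

Σ-zero : (xs : List A) {φ : A → ℕ} → (∀ x → φ x ≡ 0) → Σ[ xs ] φ ≡ 0
Σ-zero [] f = refl
Σ-zero (x ∷ xs) f = cong₂ _+_ (f x) (Σ-zero xs f)

Σ-++ : (xs ys : List A) (φ : A → ℕ) → Σ[ xs ++ ys ] φ ≡ Σ[ xs ] φ + Σ[ ys ] φ
Σ-++ [] ys φ = refl
Σ-++ (x ∷ xs) ys φ = trans (cong (φ x +_) (Σ-++ xs ys φ)) (sym (+-assoc (φ x) _ _))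

Σ-map : ∀ {B : Set} (g : A → B) (xs : List A) (φ : B → ℕ) →
  Σ[ map g xs ] φ ≡ Σ[ xs ] (λ x → φ (g x))
Σ-map g [] φ = refl
Σ-map g (x ∷ xs) φ = cong (φ (g x) +_) (Σ-map g xs φ)

Σ-concatMap : ∀ {B : Set} (g : A → List B) (xs : List A) (φ : B → ℕ) →
  Σ[ concatMap g xs ] φ ≡ Σ[ xs ] (λ x → Σ[ g x ] φ)
Σ-concatMap g [] φ = refl
Σ-concatMap g (x ∷ xs) φ =
  trans (Σ-++ (g x) (concatMap g xs) φ) (cong (Σ[ g x ] φ +_) (Σ-concatMap g xs φ))

Σ-* : (xs : List A) (c : ℕ) (φ : A → ℕ) → Σ[ xs ] (λ x → c * φ x) ≡ c * Σ[ xs ] φ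
Σ-* [] c φ = sym (*-zeroʳ c)
Σ-* (x ∷ xs) c φ = trans (cong (c * φ x +_) (Σ-* xs c φ)) (sym (*-distribˡ-+ c (φ x) _))

Σ-ind : (xs : List A) (d : Dec P) (φ : A → ℕ) → ind d (Σ[ xs ] φ) ≡ Σ[ xs ] (λ x → ind d (φ x))
Σ-ind xs (yes _) φ = refl
Σ-ind xs (no _) φ = sym (Σ-zero xs (λ _ → refl))

Σ-applyUpTo : ∀ n (g φ : ℕ → ℕ) → Σ[ applyUpTo g n ] φ ≡ sumTo n (λ i → φ (g i))
Σ-applyUpTo zero g φ = refl
Σ-applyUpTo (suc n) g φ = cong (φ (g 0) +_) (Σ-applyUpTo n (λ i → g (suc i)) φ)

Σ-box : (B : NVec N) (φ : NVec N → ℕ) → Σ[ box B ] φ ≡ sumBox B φ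
Σ-box [] φ = +-identityʳ _
Σ-box (b ∷ B) φ = begin
  Σ[ concatMap (λ a → map (a ∷_) (box B)) (upTo (suc b)) ] φ
    ≡⟨ Σ-concatMap (λ a → map (a ∷_) (box B)) (upTo (suc b)) φ ⟩
  Σ[ upTo (suc b) ] (λ a → Σ[ map (a ∷_) (box B) ] φ)
    ≡⟨ Σ-cong (upTo (suc b)) (λ a → trans (Σ-map (a ∷_) (box B) φ) (Σ-box B _)) ⟩
  Σ[ upTo (suc b) ] (λ a → sumBox B (λ x → φ (a ∷ x)))
    ≡⟨ Σ-applyUpTo (suc b) (λ i → i) (λ a → sumBox B (λ x → φ (a ∷ x))) ⟩
  sumBox (b ∷ B) φ ∎
  where open ≡-Reasoning

sumBox-Σ : (B : NVec N) (xs : List A) (φ : NVec N → A → ℕ) →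
  sumBox B (λ v → Σ[ xs ] (φ v)) ≡ Σ[ xs ] (λ x → sumBox B (λ v → φ v x))
sumBox-Σ B [] φ = sumBox-zero B (λ _ _ → refl)
sumBox-Σ B (x ∷ xs) φ =
  trans (sumBox-+ B (λ v → φ v x) (λ v → Σ[ xs ] (φ v)))
        (cong (sumBox B (λ v → φ v x) +_) (sumBox-Σ B xs φ))

sumBox-fiber : (u : NVec N) {Q : NVec N → Set} (Q? : ∀ v → Dec (Q v))
  (xs : List A) (g : A → NVec N) (c : ℕ) (φ : A → ℕ) → (∀ x → Q (g x) → g x ≤ᵥ u) →
  sumBox u (λ v → ind (Q? v) (c * Σ[ xs ] (λ x → ind (g x ≟ᵥ v) (φ x)))) ≡
  Σ[ xs ] (λ x → ind (Q? (g x)) (c * φ x))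
sumBox-fiber u Q? xs g c φ g≤u = begin
  sumBox u (λ v → ind (Q? v) (c * Σ[ xs ] (λ x → ind (g x ≟ᵥ v) (φ x))))
    ≡⟨ sumBox-cong u (λ v _ → inside v) ⟩
  sumBox u (λ v → Σ[ xs ] (λ x → ind (Q? v) (ind (g x ≟ᵥ v) (c * φ x))))
    ≡⟨ sumBox-Σ u xs _ ⟩
  Σ[ xs ] (λ x → sumBox u (λ v → ind (Q? v) (ind (g x ≟ᵥ v) (c * φ x))))
    ≡⟨ Σ-cong xs (λ x → sumBox-substitute u (g x) Q? (g≤u x)) ⟩
  Σ[ xs ] (λ x → ind (Q? (g x)) (c * φ x)) ∎
  where
  open ≡-Reasoning
  inside : ∀ v → ind (Q? v) (c * Σ[ xs ] (λ x → ind (g x ≟ᵥ v) (φ x))) ≡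
                 Σ[ xs ] (λ x → ind (Q? v) (ind (g x ≟ᵥ v) (c * φ x)))
  inside v = trans (cong (ind (Q? v)) (trans (sym (Σ-* xs c _))
                                             (Σ-cong xs (λ x → ind-*ʳ (g x ≟ᵥ v) c (φ x)))))
                   (Σ-ind xs (Q? v) _)

sumBox-fiberᵇ : (u : NVec N) {Q : NVec N → Set} (Q? : ∀ v → Dec (Q v))
  (B : NVec K) (g : NVec K → NVec N) (c : ℕ) (φ : NVec K → ℕ) → (∀ x → Q (g x) → g x ≤ᵥ u) →
  sumBox u (λ v → ind (Q? v) (c * sumBox B (λ x → ind (g x ≟ᵥ v) (φ x)))) ≡
  sumBox B (λ x → ind (Q? (g x)) (c * φ x))
sumBox-fiberᵇ u Q? B g c φ g≤u =
  trans (sumBox-cong u (λ v _ → cong (λ s → ind (Q? v) (c * s)) (sym (Σ-box B _))))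
        (trans (sumBox-fiber u Q? (box B) g c φ g≤u) (Σ-box B _))

-- Convolution on ℕ^N

infixl 7 _⋆_
_⋆_ : (X Y : NVec N → ℕ) → NVec N → ℕ
(X ⋆ Y) u = sumBox u (λ a → sumBox u (λ b → ind ((a ⊕ b) ≟ᵥ u) (X a * Y b)))

δ₀ : NVec N → ℕ
δ₀ b = ind (𝟎 ≟ᵥ b) 1

⋆-over : (B : NVec N) (X Y : NVec N → ℕ) {u : NVec N} → u ≤ᵥ B →
  (X ⋆ Y) u ≡ sumBox B (λ a → sumBox B (λ b → ind ((a ⊕ b) ≟ᵥ u) (X a * Y b)))
⋆-over B X Y {u} u≤B =
  trans (sumBox-cong u (λ a _ → sumBox-extend u B u≤B
          (λ b b≰u → ind-no ((a ⊕ b) ≟ᵥ u) (λ e → b≰u (⊕≡⇒≤ᵥʳ e)))))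
        (sumBox-extend u B u≤B
          (λ a a≰u → sumBox-zero B (λ b _ → ind-no ((a ⊕ b) ≟ᵥ u) (λ e → a≰u (⊕≡⇒≤ᵥˡ e)))))

⋆-cong : {X X′ Y Y′ : NVec N → ℕ} → X ≗ X′ → Y ≗ Y′ → X ⋆ Y ≗ X′ ⋆ Y′
⋆-cong X≗X′ Y≗Y′ u =
  sumBox-cong u (λ a _ → sumBox-cong u (λ b _ →
    cong (ind ((a ⊕ b) ≟ᵥ u)) (cong₂ _*_ (X≗X′ a) (Y≗Y′ b))))

⋆-congˡ : {X X′ : NVec N → ℕ} (Y : NVec N → ℕ) → X ≗ X′ → X ⋆ Y ≗ X′ ⋆ Y
⋆-congˡ Y X≗X′ = ⋆-cong X≗X′ (λ _ → refl)

⋆-congʳ : (X : NVec N → ℕ) {Y Y′ : NVec N → ℕ} → Y ≗ Y′ → X ⋆ Y ≗ X ⋆ Y′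
⋆-congʳ X = ⋆-cong {X = X} (λ _ → refl)

⋆-comm : (X Y : NVec N → ℕ) → X ⋆ Y ≗ Y ⋆ X
⋆-comm X Y u =
  trans (sumBox-comm u u (λ a b → ind ((a ⊕ b) ≟ᵥ u) (X a * Y b)))
        (sumBox-cong u (λ b _ → sumBox-cong u (λ a _ →
           trans (ind-⇔ ((a ⊕ b) ≟ᵥ u) ((b ⊕ a) ≟ᵥ u) (trans (⊕-comm b a)) (trans (⊕-comm a b)))
                 (cong (ind ((b ⊕ a) ≟ᵥ u)) (*-comm (X a) (Y b))))))

⋆-distribˡ-+ : (X Y Z : NVec N → ℕ) → X ⋆ (λ b → Y b + Z b) ≗ λ u → (X ⋆ Y) u + (X ⋆ Z) u
⋆-distribˡ-+ X Y Z u = begin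
  (X ⋆ (λ b → Y b + Z b)) u
    ≡⟨ sumBox-cong u (λ a _ → sumBox-cong u (λ b _ → split a b)) ⟩
  sumBox u (λ a → sumBox u (λ b → ind (E a b) (X a * Y b) + ind (E a b) (X a * Z b)))
    ≡⟨ sumBox-cong u (λ a _ → sumBox-+ u _ _) ⟩
  sumBox u (λ a → sumBox u (λ b → ind (E a b) (X a * Y b)) + sumBox u (λ b → ind (E a b) (X a * Z b)))
    ≡⟨ sumBox-+ u _ _ ⟩
  (X ⋆ Y) u + (X ⋆ Z) u ∎
  where
  open ≡-Reasoning
  E : ∀ a b → Dec (a ⊕ b ≡ u)
  E a b = (a ⊕ b) ≟ᵥ u
  split : ∀ a b → ind (E a b) (X a * (Y b + Z b)) ≡ ind (E a b) (X a * Y b) + ind (E a b) (X a * Z b)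
  split a b = trans (cong (ind (E a b)) (*-distribˡ-+ (X a) (Y b) (Z b))) (ind-+ (E a b) _ _)

⋆-distribʳ-+ : (X Y Z : NVec N → ℕ) → (λ a → X a + Y a) ⋆ Z ≗ λ u → (X ⋆ Z) u + (Y ⋆ Z) u
⋆-distribʳ-+ X Y Z u =
  trans (⋆-comm _ Z u)
        (trans (⋆-distribˡ-+ Z X Y u) (cong₂ _+_ (⋆-comm Z X u) (⋆-comm Z Y u)))

⋆-*ʳ : (X Y : NVec N → ℕ) (c : ℕ) → X ⋆ (λ b → c * Y b) ≗ λ u → c * (X ⋆ Y) u
⋆-*ʳ X Y c u =
  trans (sumBox-cong u (λ a _ → trans (sumBox-cong u (λ b _ → pull a b))
                                       (sumBox-* u c (λ b → ind ((a ⊕ b) ≟ᵥ u) (X a * Y b)))))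
        (sumBox-* u c _)
  where
  pull : ∀ a b → ind ((a ⊕ b) ≟ᵥ u) (X a * (c * Y b)) ≡ c * ind ((a ⊕ b) ≟ᵥ u) (X a * Y b)
  pull a b = trans (cong (ind ((a ⊕ b) ≟ᵥ u)) (x*[c*y]≡c*[x*y] (X a) c (Y b)))
                   (sym (ind-*ʳ ((a ⊕ b) ≟ᵥ u) c _))
    where
    x*[c*y]≡c*[x*y] : ∀ x c y → x * (c * y) ≡ c * (x * y)
    x*[c*y]≡c*[x*y] = solve-∀

⋆-*ˡ : (X Y : NVec N → ℕ) (c : ℕ) → (λ a → c * X a) ⋆ Y ≗ λ u → c * (X ⋆ Y) u
⋆-*ˡ X Y c u = trans (⋆-comm _ Y u) (trans (⋆-*ʳ Y X c u) (cong (c *_) (⋆-comm Y X u)))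

⋆-∣ : (X Y : NVec N → ℕ) {m : ℕ} (u : NVec N) → (∀ a b → m ∣ₙ X a * Y b) → m ∣ₙ (X ⋆ Y) u
⋆-∣ X Y u m∣XY = sumBox-∣ u (λ a → sumBox-∣ u (λ b → ind-∣ ((a ⊕ b) ≟ᵥ u) (λ _ → m∣XY a b)))

⋆-identityʳ : (X : NVec N → ℕ) → X ⋆ δ₀ ≗ X
⋆-identityʳ X u = begin
  (X ⋆ δ₀) u
    ≡⟨ sumBox-cong u (λ a _ → sumBox-cong u (λ b _ → unit a b)) ⟩
  sumBox u (λ a → sumBox u (λ b → ind ((a ⊕ b) ≟ᵥ u) (ind (𝟎 ≟ᵥ b) (X a))))
    ≡⟨ sumBox-cong u (λ a _ → sumBox-substitute u 𝟎 (λ b → (a ⊕ b) ≟ᵥ u) (λ _ → 𝟎≤ᵥ u)) ⟩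
  sumBox u (λ a → ind ((a ⊕ 𝟎) ≟ᵥ u) (X a))
    ≡⟨ sumBox-cong u (λ a _ → ind-⇔ ((a ⊕ 𝟎) ≟ᵥ u) (u ≟ᵥ a)
                                     (λ e → trans (sym e) (⊕-identityʳ a))
                                     (λ e → trans (⊕-identityʳ a) (sym e))) ⟩
  sumBox u (λ a → ind (u ≟ᵥ a) (X a))
    ≡⟨ sumBox-δ u u X ≤ᵥ-refl ⟩
  X u ∎
  where
  open ≡-Reasoning
  unit : ∀ a b → ind ((a ⊕ b) ≟ᵥ u) (X a * δ₀ b) ≡ ind ((a ⊕ b) ≟ᵥ u) (ind (𝟎 ≟ᵥ b) (X a))
  unit a b = cong (ind ((a ⊕ b) ≟ᵥ u))
                  (trans (ind-*ʳ (𝟎 ≟ᵥ b) (X a) 1) (ind-cong (𝟎 ≟ᵥ b) (λ _ → *-identityʳ (X a))))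

⋆-identityˡ : (X : NVec N → ℕ) → δ₀ ⋆ X ≗ X
⋆-identityˡ X u = trans (⋆-comm δ₀ X u) (⋆-identityʳ X u)

sumBox-⋆ : (u : NVec N) {Q : NVec N → Set} (Q? : ∀ v → Dec (Q v)) (Y Z : NVec N → ℕ) →
  (∀ v → Q v → v ≤ᵥ u) →
  sumBox u (λ v → ind (Q? v) ((Y ⋆ Z) v)) ≡
  sumBox u (λ y → sumBox u (λ z → ind (Q? (y ⊕ z)) (Y y * Z z)))
sumBox-⋆ u Q? Y Z Q⇒≤u = begin
  sumBox u (λ v → ind (Q? v) ((Y ⋆ Z) v))
    ≡⟨ sumBox-cong u (λ v _ → ind-cong (Q? v) (λ q → factored (Q⇒≤u v q))) ⟩
  sumBox u (λ v → ind (Q? v) (sumBox u (λ y → Y y * S y v)))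
    ≡⟨ sumBox-cong u (λ v _ → sumBox-ind u (Q? v) _) ⟩
  sumBox u (λ v → sumBox u (λ y → ind (Q? v) (Y y * S y v)))
    ≡⟨ sumBox-comm u u _ ⟩
  sumBox u (λ y → sumBox u (λ v → ind (Q? v) (Y y * S y v)))
    ≡⟨ sumBox-cong u (λ y _ → sumBox-fiberᵇ u Q? u (y ⊕_) (Y y) Z (λ z → Q⇒≤u (y ⊕ z))) ⟩
  sumBox u (λ y → sumBox u (λ z → ind (Q? (y ⊕ z)) (Y y * Z z))) ∎
  where
  open ≡-Reasoning
  S : NVec _ → NVec _ → ℕ
  S y v = sumBox u (λ z → ind ((y ⊕ z) ≟ᵥ v) (Z z))
  factored : ∀ {v} → v ≤ᵥ u → (Y ⋆ Z) v ≡ sumBox u (λ y → Y y * S y v)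
  factored {v} v≤u =
    trans (⋆-over u Y Z v≤u)
          (sumBox-cong u (λ y _ → trans (sumBox-cong u (λ z _ → sym (ind-*ʳ ((y ⊕ z) ≟ᵥ v) (Y y) (Z z))))
                                        (sumBox-* u (Y y) _)))

⋆-⋆-expand : (X Y Z : NVec N → ℕ) (u : NVec N) →
  (X ⋆ (Y ⋆ Z)) u ≡
  sumBox u (λ a → sumBox u (λ b → sumBox u (λ c → ind ((a ⊕ (b ⊕ c)) ≟ᵥ u) (X a * Y b * Z c))))
⋆-⋆-expand X Y Z u =
  sumBox-cong u (λ a _ →
    trans (sumBox-cong u (λ v _ → cong (ind ((a ⊕ v) ≟ᵥ u)) (sym (⋆-*ˡ Y Z (X a) v))))
          (sumBox-⋆ u (λ v → (a ⊕ v) ≟ᵥ u) (λ b → X a * Y b) Z (λ v → ⊕≡⇒≤ᵥʳ)))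

⋆-assoc : (X Y Z : NVec N → ℕ) → X ⋆ (Y ⋆ Z) ≗ (X ⋆ Y) ⋆ Z
⋆-assoc X Y Z u = begin
  (X ⋆ (Y ⋆ Z)) u
    ≡⟨ ⋆-⋆-expand X Y Z u ⟩
  sumBox u (λ a → sumBox u (λ b → sumBox u (λ c → ind ((a ⊕ (b ⊕ c)) ≟ᵥ u) (X a * Y b * Z c))))
    ≡⟨ sumBox-cong u (λ a _ → sumBox-cong u (λ b _ → sumBox-cong u (λ c _ → rotate a b c))) ⟩
  sumBox u (λ a → sumBox u (λ b → sumBox u (λ c → ind ((c ⊕ (a ⊕ b)) ≟ᵥ u) (Z c * X a * Y b))))
    ≡⟨ sumBox-cong u (λ a _ → sumBox-comm u u _) ⟩
  sumBox u (λ a → sumBox u (λ c → sumBox u (λ b → ind ((c ⊕ (a ⊕ b)) ≟ᵥ u) (Z c * X a * Y b))))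
    ≡⟨ sumBox-comm u u _ ⟩
  sumBox u (λ c → sumBox u (λ a → sumBox u (λ b → ind ((c ⊕ (a ⊕ b)) ≟ᵥ u) (Z c * X a * Y b))))
    ≡⟨ sym (⋆-⋆-expand Z X Y u) ⟩
  (Z ⋆ (X ⋆ Y)) u
    ≡⟨ ⋆-comm Z (X ⋆ Y) u ⟩
  ((X ⋆ Y) ⋆ Z) u ∎
  where
  open ≡-Reasoning
  rotate : ∀ a b c → ind ((a ⊕ (b ⊕ c)) ≟ᵥ u) (X a * Y b * Z c) ≡
                     ind ((c ⊕ (a ⊕ b)) ≟ᵥ u) (Z c * X a * Y b)
  rotate a b c =
    trans (ind-⇔ ((a ⊕ (b ⊕ c)) ≟ᵥ u) ((c ⊕ (a ⊕ b)) ≟ᵥ u) (trans rot) (trans (sym rot)))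
          (cong (ind ((c ⊕ (a ⊕ b)) ≟ᵥ u)) (x*y*z≡z*x*y (X a) (Y b) (Z c)))
    where
    rot : c ⊕ (a ⊕ b) ≡ a ⊕ (b ⊕ c)
    rot = trans (⊕-comm c (a ⊕ b)) (⊕-assoc a b c)
    x*y*z≡z*x*y : ∀ x y z → x * y * z ≡ z * x * y
    x*y*z≡z*x*y = solve-∀

⋆-left-comm : (X Y Z : NVec N → ℕ) → X ⋆ (Y ⋆ Z) ≗ Y ⋆ (X ⋆ Z)
⋆-left-comm X Y Z u =
  trans (⋆-assoc X Y Z u)
        (trans (⋆-congˡ Z (⋆-comm X Y) u) (sym (⋆-assoc Y X Z u)))

-- binom h k is the k-th convolution power of h

Σ-tuples : ∀ k (xs : List A) (ψ : Vec A (suc k) → ℕ) →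
  Σ[ tuples (suc k) xs ] ψ ≡ Σ[ xs ] (λ a → Σ[ tuples k xs ] (λ t → ψ (a ∷ t)))
Σ-tuples k xs ψ =
  trans (Σ-concatMap (λ a → map (a ∷_) (tuples k xs)) xs ψ)
        (Σ-cong xs (λ a → Σ-map (a ∷_) (tuples k xs) ψ))

Σ-tuples-extend : ∀ k (w B : NVec N) (ψ : Vec (NVec N) k → ℕ) → w ≤ᵥ B →
  (∀ ts → ¬ All (_≤ᵥ w) ts → ψ ts ≡ 0) → Σ[ tuples k (box w) ] ψ ≡ Σ[ tuples k (box B) ] ψ
Σ-tuples-extend zero w B ψ _ _ = refl
Σ-tuples-extend (suc k) w B ψ w≤B vanish = begin
  Σ[ tuples (suc k) (box w) ] ψ
    ≡⟨ Σ-tuples k (box w) ψ ⟩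
  Σ[ box w ] (λ a → Σ[ tuples k (box w) ] (λ t → ψ (a ∷ t)))
    ≡⟨ Σ-cong (box w) (λ a → Σ-tuples-extend k w B (λ t → ψ (a ∷ t)) w≤B
                               (λ ts ¬all → vanish (a ∷ ts) (λ all → ¬all (All.tail all)))) ⟩
  Σ[ box w ] (λ a → Σ[ tuples k (box B) ] (λ t → ψ (a ∷ t)))
    ≡⟨ Σ-box w _ ⟩
  sumBox w (λ a → Σ[ tuples k (box B) ] (λ t → ψ (a ∷ t)))
    ≡⟨ sumBox-extend w B w≤B (λ a a≰w → Σ-zero (tuples k (box B))
                                 (λ ts → vanish (a ∷ ts) (λ all → a≰w (All.head all)))) ⟩
  sumBox B (λ a → Σ[ tuples k (box B) ] (λ t → ψ (a ∷ t)))
    ≡⟨ sym (Σ-box B _) ⟩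
  Σ[ box B ] (λ a → Σ[ tuples k (box B) ] (λ t → ψ (a ∷ t)))
    ≡⟨ sym (Σ-tuples k (box B) ψ) ⟩
  Σ[ tuples (suc k) (box B) ] ψ ∎
  where open ≡-Reasoning

summands≤ᵥvsum : ∀ {k} (ts : Vec (NVec N) k) → All (_≤ᵥ vsum ts) ts
summands≤ᵥvsum [] = []
summands≤ᵥvsum (a ∷ ts) =
  x≤ᵥx⊕y a (vsum ts) ∷ All.map (λ t≤ → ≤ᵥ-trans t≤ (⊕≡⇒≤ᵥʳ refl)) (summands≤ᵥvsum ts)

binom-over : (h : NVec N → ℕ) (k : ℕ) (B : NVec N) {u : NVec N} → u ≤ᵥ B →
  binom h k u ≡ Σ[ tuples k (box B) ] (λ ts → ind (vsum ts ≟ᵥ u) (prodH h ts))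
binom-over h k B {u} u≤B =
  Σ-tuples-extend k u B _ u≤B (λ ts ¬all → ind-no (vsum ts ≟ᵥ u)
    (λ e → ¬all (subst (λ w → All (_≤ᵥ w) ts) e (summands≤ᵥvsum ts))))

binom-zero : (h : NVec N → ℕ) → binom h 0 ≗ δ₀
binom-zero h u = +-identityʳ _

binom-suc : (h : NVec N → ℕ) (k : ℕ) → binom h (suc k) ≗ h ⋆ binom h k
binom-suc h k u = begin
  binom h (suc k) u
    ≡⟨ Σ-tuples k (box u) _ ⟩
  Σ[ box u ] (λ a → Σ[ T ] (λ t → ind ((a ⊕ vsum t) ≟ᵥ u) (h a * prodH h t)))
    ≡⟨ Σ-box u _ ⟩
  sumBox u (λ a → Σ[ T ] (λ t → ind ((a ⊕ vsum t) ≟ᵥ u) (h a * prodH h t)))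
    ≡⟨ sumBox-cong u (λ a _ → sym (sumBox-fiber u (λ v → (a ⊕ v) ≟ᵥ u) T vsum (h a) (prodH h)
                                                (λ _ → ⊕≡⇒≤ᵥʳ))) ⟩
  sumBox u (λ a → sumBox u (λ v → ind ((a ⊕ v) ≟ᵥ u)
                                      (h a * Σ[ T ] (λ t → ind (vsum t ≟ᵥ v) (prodH h t)))))
    ≡⟨ sumBox-cong u (λ a _ → sumBox-cong u (λ v _ → ind-cong ((a ⊕ v) ≟ᵥ u)
                     (λ e → cong (h a *_) (sym (binom-over h k u (⊕≡⇒≤ᵥʳ e)))))) ⟩
  (h ⋆ binom h k) u ∎
  where
  open ≡-Reasoning
  T : List (Vec (NVec _) k)
  T = tuples k (box u)

binom-one : (h : NVec N → ℕ) → binom h 1 ≗ h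
binom-one h u =
  trans (binom-suc h 0 u) (trans (⋆-congʳ h (binom-zero h) u) (⋆-identityʳ h u))

binom-cong : {h h′ : NVec N → ℕ} → h ≗ h′ → ∀ n → binom h n ≗ binom h′ n
binom-cong h≗h′ zero u = refl
binom-cong {h = h} {h′} h≗h′ (suc n) u =
  trans (binom-suc h n u)
        (trans (⋆-cong h≗h′ (binom-cong h≗h′ n) u) (sym (binom-suc h′ n u)))

binom-+ : (h : NVec N → ℕ) (a b : ℕ) → binom h (a + b) ≗ binom h a ⋆ binom h b
binom-+ h zero b u =
  sym (trans (⋆-congˡ (binom h b) (binom-zero h) u) (⋆-identityˡ (binom h b) u))
binom-+ h (suc a) b u =
  trans (binom-suc h (a + b) u)
  (trans (⋆-congʳ h (binom-+ h a b) u)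
  (trans (⋆-assoc h (binom h a) (binom h b) u)
         (⋆-congˡ (binom h b) (λ v → sym (binom-suc h a v)) u)))

binom-* : (h : NVec N → ℕ) (k n : ℕ) → binom (binom h k) n ≗ binom h (n * k)
binom-* h k zero u = refl
binom-* h k (suc n) u =
  trans (binom-suc (binom h k) n u)
        (trans (⋆-congʳ (binom h k) (binom-* h k n) u) (sym (binom-+ h k (n * k) u)))

-- Divisibility of binom h p off the lattice pℕ^N

weighted : Fin N → (NVec N → ℕ) → NVec N → ℕ
weighted j X a = lookup a j * X a

⋆-leibniz : (j : Fin N) (X Y : NVec N → ℕ) →
  (λ u → lookup u j * (X ⋆ Y) u) ≗ λ u → (weighted j X ⋆ Y) u + (X ⋆ weighted j Y) u
⋆-leibniz j X Y u = begin
  lookup u j * (X ⋆ Y) u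
    ≡⟨ sym (sumBox-* u (lookup u j) _) ⟩
  sumBox u (λ a → lookup u j * sumBox u (λ b → ind (E a b) (X a * Y b)))
    ≡⟨ sumBox-cong u (λ a _ → trans (sym (sumBox-* u (lookup u j) _))
                                     (sumBox-cong u (λ b _ → split a b))) ⟩
  sumBox u (λ a → sumBox u (λ b → ind (E a b) (weighted j X a * Y b) +
                                  ind (E a b) (X a * weighted j Y b)))
    ≡⟨ sumBox-cong u (λ a _ → sumBox-+ u _ _) ⟩
  sumBox u (λ a → sumBox u (λ b → ind (E a b) (weighted j X a * Y b)) +
                  sumBox u (λ b → ind (E a b) (X a * weighted j Y b)))
    ≡⟨ sumBox-+ u _ _ ⟩
  (weighted j X ⋆ Y) u + (X ⋆ weighted j Y) u ∎
  where
  open ≡-Reasoning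
  E : ∀ a b → Dec (a ⊕ b ≡ u)
  E a b = (a ⊕ b) ≟ᵥ u
  distribute : ∀ a₀ b₀ x y → (a₀ + b₀) * (x * y) ≡ a₀ * x * y + x * (b₀ * y)
  distribute = solve-∀
  split : ∀ a b → lookup u j * ind (E a b) (X a * Y b) ≡
                  ind (E a b) (weighted j X a * Y b) + ind (E a b) (X a * weighted j Y b)
  split a b =
    trans (ind-*ʳ (E a b) (lookup u j) _)
    (trans (ind-cong (E a b) (λ { refl →
              trans (cong (_* (X a * Y b)) (lookup-zipWith _+_ j a b))
                    (distribute (lookup a j) (lookup b j) (X a) (Y b)) }))
           (ind-+ (E a b) _ _))

lookup-*-binom-suc : (j : Fin N) (h : NVec N → ℕ) (k : ℕ) →
  (λ u → lookup u j * binom h (suc k) u) ≗ λ u → suc k * (weighted j h ⋆ binom h k) u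
lookup-*-binom-suc j h zero u = begin
  lookup u j * binom h 1 u         ≡⟨ cong (lookup u j *_) (binom-one h u) ⟩
  weighted j h u                   ≡⟨ sym (⋆-identityʳ (weighted j h) u) ⟩
  (weighted j h ⋆ δ₀) u            ≡⟨ ⋆-congʳ (weighted j h) (λ v → sym (binom-zero h v)) u ⟩
  (weighted j h ⋆ binom h 0) u     ≡⟨ sym (*-identityˡ _) ⟩
  1 * (weighted j h ⋆ binom h 0) u ∎
  where open ≡-Reasoning
lookup-*-binom-suc j h (suc k) u = begin
  lookup u j * binom h (suc (suc k)) u
    ≡⟨ cong (lookup u j *_) (binom-suc h (suc k) u) ⟩
  lookup u j * (h ⋆ H₁) u
    ≡⟨ ⋆-leibniz j h H₁ u ⟩
  (hⱼ ⋆ H₁) u + (h ⋆ weighted j H₁) u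
    ≡⟨ cong ((hⱼ ⋆ H₁) u +_) (⋆-congʳ h (lookup-*-binom-suc j h k) u) ⟩
  (hⱼ ⋆ H₁) u + (h ⋆ (λ v → suc k * (hⱼ ⋆ H₀) v)) u
    ≡⟨ cong ((hⱼ ⋆ H₁) u +_) (⋆-*ʳ h (hⱼ ⋆ H₀) (suc k) u) ⟩
  (hⱼ ⋆ H₁) u + suc k * (h ⋆ (hⱼ ⋆ H₀)) u
    ≡⟨ cong (λ s → (hⱼ ⋆ H₁) u + suc k * s) (⋆-left-comm h hⱼ H₀ u) ⟩
  (hⱼ ⋆ H₁) u + suc k * (hⱼ ⋆ (h ⋆ H₀)) u
    ≡⟨ cong (λ s → (hⱼ ⋆ H₁) u + suc k * s) (⋆-congʳ hⱼ (λ v → sym (binom-suc h k v)) u) ⟩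
  suc (suc k) * (hⱼ ⋆ H₁) u ∎
  where
  open ≡-Reasoning
  hⱼ H₀ H₁ : NVec _ → ℕ
  hⱼ = weighted j h
  H₀ = binom h k
  H₁ = binom h (suc k)

p∣binom-p : ∀ {p} (h : NVec N → ℕ) → Prime p → {u : NVec N} → ¬ DivBy p u → p ∣ₙ binom h p u
p∣binom-p {p = suc k} h p-prime {u} u∉pℕᴺ with ¬DivBy⇒coordinate (suc k) u∉pℕᴺ
... | j , p∤uⱼ with euclidsLemma (lookup u j) (binom h (suc k) u) p-prime
                      (subst (suc k ∣ₙ_) (sym (lookup-*-binom-suc j h k u)) (m∣m*n _))
...   | inj₁ p∣uⱼ = ⊥-elim (p∤uⱼ p∣uⱼ)
...   | inj₂ p∣binom = p∣binom

infix 4 _≡_+multipleOf_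
_≡_+multipleOf_ : ℕ → ℕ → ℕ → Set
a ≡ b +multipleOf m = ∃ λ e → m ∣ₙ e × a ≡ b + e

≡⇒+multipleOf : ∀ {a b} m → a ≡ b → a ≡ b +multipleOf m
≡⇒+multipleOf {b = b} m a≡b = 0 , m ∣ₙ0 , trans a≡b (sym (+-identityʳ b))

+multipleOf-trans : ∀ {a b c m} → a ≡ b +multipleOf m → b ≡ c +multipleOf m → a ≡ c +multipleOf m
+multipleOf-trans {c = c} (d , m∣d , a≡b+d) (e , m∣e , b≡c+e) =
  e + d , ∣m∣n⇒∣m+n m∣e m∣d , trans a≡b+d (trans (cong (_+ d) b≡c+e) (+-assoc c e d))

⋆-+multipleOfʳ : ∀ {m} (X : NVec N → ℕ) {Y Y′ : NVec N → ℕ} →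
  (∀ v → Y v ≡ Y′ v +multipleOf m) → ∀ u → (X ⋆ Y) u ≡ (X ⋆ Y′) u +multipleOf m
⋆-+multipleOfʳ X {Y} {Y′} Y≡Y′ u =
  (X ⋆ E) u ,
  ⋆-∣ X E u (λ a b → ∣n⇒∣m*n (X a) (proj₁ (proj₂ (Y≡Y′ b)))) ,
  trans (⋆-congʳ X (λ v → proj₂ (proj₂ (Y≡Y′ v))) u) (⋆-distribˡ-+ X Y′ E u)
  where
  E : NVec _ → ℕ
  E v = proj₁ (Y≡Y′ v)

-- First-order binomial expansion

module _ {m : ℕ} (A B : NVec N → ℕ) (m∣B : ∀ u → m ∣ₙ B u) where

  binom-+-firstOrder-suc : ∀ n u →
    binom (λ v → A v + B v) (suc n) u ≡
      binom A (suc n) u + suc n * (B ⋆ binom A n) u +multipleOf (m * m)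
  binom-+-firstOrder-suc zero u = ≡⇒+multipleOf (m * m) (begin
    binom (λ v → A v + B v) 1 u       ≡⟨ binom-one _ u ⟩
    A u + B u                         ≡⟨ cong₂ _+_ (sym (binom-one A u)) (sym B≡B⋆binom-A-0) ⟩
    binom A 1 u + 1 * (B ⋆ binom A 0) u ∎)
    where
    open ≡-Reasoning
    B≡B⋆binom-A-0 : 1 * (B ⋆ binom A 0) u ≡ B u
    B≡B⋆binom-A-0 = trans (*-identityˡ _) (trans (⋆-congʳ B (binom-zero A) u) (⋆-identityʳ B u))
  binom-+-firstOrder-suc (suc n) u =
    +multipleOf-trans
      (subst (λ s → s ≡ (S ⋆ T) u +multipleOf (m * m)) (sym (binom-suc S (suc n) u))
             (⋆-+multipleOfʳ S (binom-+-firstOrder-suc n) u))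
      (suc n * (B ⋆ R) u , ∣n⇒∣m*n (suc n) m²∣B⋆R , expand)
    where
    open ≡-Reasoning
    S A₁ R T : NVec _ → ℕ
    S v = A v + B v
    A₁ = binom A (suc n)
    R = B ⋆ binom A n
    T v = A₁ v + suc n * R v
    m²∣B⋆R : m * m ∣ₙ (B ⋆ R) u
    m²∣B⋆R = ⋆-∣ B R u (λ a b → *-pres-∣ (m∣B a)
                         (⋆-∣ B (binom A n) b (λ a′ _ → ∣m⇒∣m*n _ (m∣B a′))))
    A⋆R≡B⋆A₁ : (A ⋆ R) u ≡ (B ⋆ A₁) u
    A⋆R≡B⋆A₁ = trans (⋆-left-comm A B (binom A n) u) (⋆-congʳ B (λ v → sym (binom-suc A n v)) u)
    split : (X : NVec _ → ℕ) → (X ⋆ T) u ≡ (X ⋆ A₁) u + suc n * (X ⋆ R) u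
    split X = trans (⋆-distribˡ-+ X A₁ _ u) (cong ((X ⋆ A₁) u +_) (⋆-*ʳ X R (suc n) u))
    collect : ∀ a k c d → (a + k * c) + (c + k * d) ≡ a + (c + k * c) + k * d
    collect = solve-∀
    expand : (S ⋆ T) u ≡ binom A (suc (suc n)) u + suc (suc n) * (B ⋆ A₁) u + suc n * (B ⋆ R) u
    expand = begin
      (S ⋆ T) u
        ≡⟨ ⋆-distribʳ-+ A B T u ⟩
      (A ⋆ T) u + (B ⋆ T) u
        ≡⟨ cong₂ _+_ (split A) (split B) ⟩
      ((A ⋆ A₁) u + suc n * (A ⋆ R) u) + ((B ⋆ A₁) u + suc n * (B ⋆ R) u)
        ≡⟨ cong₂ (λ x y → (x + suc n * y) + ((B ⋆ A₁) u + suc n * (B ⋆ R) u))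
                 (sym (binom-suc A (suc n) u)) A⋆R≡B⋆A₁ ⟩
      (binom A (suc (suc n)) u + suc n * (B ⋆ A₁) u) + ((B ⋆ A₁) u + suc n * (B ⋆ R) u)
        ≡⟨ collect (binom A (suc (suc n)) u) (suc n) ((B ⋆ A₁) u) ((B ⋆ R) u) ⟩
      binom A (suc (suc n)) u + suc (suc n) * (B ⋆ A₁) u + suc n * (B ⋆ R) u ∎

  binom-+-firstOrder : ∀ n u →
    binom (λ v → A v + B v) n u ≡
      binom A n u + n * (B ⋆ binom A (n ∸ 1)) u +multipleOf (m * m)
  binom-+-firstOrder zero u = ≡⇒+multipleOf (m * m) (sym (+-identityʳ _))
  binom-+-firstOrder (suc n) = binom-+-firstOrder-suc n

-- Dilation by p

dilate : ℕ → (NVec N → ℕ) → NVec N → ℕ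
dilate p Y u = sumBox u (λ x → ind ((p · x) ≟ᵥ u) (Y x))

dilate-cong : (p : ℕ) {Y Y′ : NVec N → ℕ} → Y ≗ Y′ → dilate p Y ≗ dilate p Y′
dilate-cong p Y≗Y′ u = sumBox-cong u (λ x _ → cong (ind ((p · x) ≟ᵥ u)) (Y≗Y′ x))

dilate-off : (p : ℕ) (Y : NVec N → ℕ) {u : NVec N} → (∀ x → p · x ≢ u) → dilate p Y u ≡ 0
dilate-off p Y {u} u∉pℕᴺ = sumBox-zero u (λ x _ → ind-no ((p · x) ≟ᵥ u) (u∉pℕᴺ x))

dilate-δ₀ : (p : ℕ) → dilate p δ₀ ≗ δ₀ {N}
dilate-δ₀ p u =
  trans (sumBox-cong u (λ x _ → ind-comm ((p · x) ≟ᵥ u) (𝟎 ≟ᵥ x)))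
  (trans (sumBox-δ u 𝟎 (λ x → ind ((p · x) ≟ᵥ u) 1) (𝟎≤ᵥ u))
         (ind-⇔ ((p · 𝟎) ≟ᵥ u) (𝟎 ≟ᵥ u) (trans (sym (·-zeroʳ p))) (trans (·-zeroʳ p))))

module _ (p : ℕ) .{{_ : NonZero p}} where

  dilate-· : (Y : NVec N → ℕ) (y : NVec N) → dilate p Y (p · y) ≡ Y y
  dilate-· Y y =
    trans (sumBox-cong (p · y) (λ x _ → ind-⇔ ((p · x) ≟ᵥ (p · y)) (y ≟ᵥ x)
                                          (λ e → sym (·-cancelˡ p e)) (λ e → cong (p ·_) (sym e))))
          (sumBox-δ (p · y) y Y (x≤ᵥp·x p y))

  dilate-over : (B : NVec N) (Y : NVec N → ℕ) {v : NVec N} → v ≤ᵥ B →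
    dilate p Y v ≡ sumBox B (λ x → ind ((p · x) ≟ᵥ v) (Y x))
  dilate-over B Y {v} v≤B =
    sumBox-extend v B v≤B (λ x x≰v → ind-no ((p · x) ≟ᵥ v) (λ { refl → x≰v (x≤ᵥp·x p x) }))

  sumBox-dilate : (u : NVec N) {Q : NVec N → Set} (Q? : ∀ v → Dec (Q v)) (c : ℕ) (Y : NVec N → ℕ) →
    (∀ v → Q v → v ≤ᵥ u) →
    sumBox u (λ v → ind (Q? v) (c * dilate p Y v)) ≡ sumBox u (λ x → ind (Q? (p · x)) (c * Y x))
  sumBox-dilate u Q? c Y Q⇒≤u =
    trans (sumBox-cong u (λ v _ → ind-cong (Q? v) (λ q → cong (c *_) (dilate-over u Y (Q⇒≤u v q)))))
          (sumBox-fiberᵇ u Q? u (p ·_) c Y (λ x → Q⇒≤u (p · x)))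

  ⋆-dilate : (X Y : NVec N → ℕ) (u : NVec N) →
    (X ⋆ dilate p Y) u ≡ sumBox u (λ k → sumBox u (λ x → ind ((k ⊕ (p · x)) ≟ᵥ u) (X k * Y x)))
  ⋆-dilate X Y u =
    sumBox-cong u (λ k _ → sumBox-dilate u (λ v → (k ⊕ v) ≟ᵥ u) (X k) Y (λ _ → ⊕≡⇒≤ᵥʳ))

  dilate-⋆ : (Y Z : NVec N → ℕ) → dilate p (Y ⋆ Z) ≗ dilate p Y ⋆ dilate p Z
  dilate-⋆ Y Z u = begin
    dilate p (Y ⋆ Z) u
      ≡⟨ sumBox-⋆ u (λ x → (p · x) ≟ᵥ u) Y Z (λ x e → subst (x ≤ᵥ_) e (x≤ᵥp·x p x)) ⟩
    sumBox u (λ y → sumBox u (λ z → ind ((p · (y ⊕ z)) ≟ᵥ u) (Y y * Z z)))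
      ≡⟨ sumBox-cong u (λ y _ → sumBox-cong u (λ z _ → reorder y z)) ⟩
    sumBox u (λ y → sumBox u (λ z → ind (((p · y) ⊕ (p · z)) ≟ᵥ u) (Z z * Y y)))
      ≡⟨ sumBox-comm u u _ ⟩
    sumBox u (λ z → sumBox u (λ y → ind (((p · y) ⊕ (p · z)) ≟ᵥ u) (Z z * Y y)))
      ≡⟨ sumBox-cong u (λ z _ → sym (sumBox-dilate u (λ a → (a ⊕ (p · z)) ≟ᵥ u) (Z z) Y
                                                   (λ _ → ⊕≡⇒≤ᵥˡ))) ⟩
    sumBox u (λ z → sumBox u (λ a → ind ((a ⊕ (p · z)) ≟ᵥ u) (Z z * dilate p Y a)))
      ≡⟨ sumBox-cong u (λ z _ → sumBox-cong u (λ a _ →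
           cong (ind ((a ⊕ (p · z)) ≟ᵥ u)) (*-comm (Z z) (dilate p Y a)))) ⟩
    sumBox u (λ z → sumBox u (λ a → ind ((a ⊕ (p · z)) ≟ᵥ u) (dilate p Y a * Z z)))
      ≡⟨ sumBox-comm u u _ ⟩
    sumBox u (λ a → sumBox u (λ z → ind ((a ⊕ (p · z)) ≟ᵥ u) (dilate p Y a * Z z)))
      ≡⟨ sym (⋆-dilate (dilate p Y) Z u) ⟩
    (dilate p Y ⋆ dilate p Z) u ∎
    where
    open ≡-Reasoning
    reorder : ∀ y z → ind ((p · (y ⊕ z)) ≟ᵥ u) (Y y * Z z) ≡
                      ind (((p · y) ⊕ (p · z)) ≟ᵥ u) (Z z * Y y)
    reorder y z =
      trans (ind-⇔ ((p · (y ⊕ z)) ≟ᵥ u) (((p · y) ⊕ (p · z)) ≟ᵥ u)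
                   (trans (sym (·-distrib-⊕ p y z))) (trans (·-distrib-⊕ p y z)))
            (cong (ind (((p · y) ⊕ (p · z)) ≟ᵥ u)) (*-comm (Y y) (Z z)))

  binom-dilate : (Y : NVec N → ℕ) → ∀ n → binom (dilate p Y) n ≗ dilate p (binom Y n)
  binom-dilate Y zero u =
    trans (binom-zero (dilate p Y) u) (sym (trans (dilate-cong p (binom-zero Y) u) (dilate-δ₀ p u)))
  binom-dilate Y (suc n) u = begin
    binom (dilate p Y) (suc n) u           ≡⟨ binom-suc _ n u ⟩
    (dilate p Y ⋆ binom (dilate p Y) n) u  ≡⟨ ⋆-congʳ (dilate p Y) (binom-dilate Y n) u ⟩
    (dilate p Y ⋆ dilate p (binom Y n)) u  ≡⟨ sym (dilate-⋆ Y (binom Y n) u) ⟩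
    dilate p (Y ⋆ binom Y n) u             ≡⟨ dilate-cong p (λ v → sym (binom-suc Y n v)) u ⟩
    dilate p (binom Y (suc n)) u           ∎
    where open ≡-Reasoning

module _ {N : ℕ} (f : NVec N → ℕ) (p : ℕ) (p-prime : Prime p) where

  private
    instance
      p≢0 : NonZero p
      p≢0 = prime⇒nonZero p-prime

    F G Fₒ : NVec N → ℕ
    F = binom f p
    G y = F (p · y)
    Fₒ u = ind (¬? (all? (p ∣?_) u)) (F u)

  F-split : F ≗ λ u → dilate p G u + Fₒ u
  F-split u with all? (p ∣?_) u
  ... | yes u∈pℕᴺ with DivBy⇒· p u∈pℕᴺ
  ...   | y , refl = trans (sym (dilate-· p G y)) (sym (+-identityʳ _))
  F-split u | no u∉pℕᴺ =
    sym (cong (_+ F u) (dilate-off p G (λ x e → u∉pℕᴺ (subst (DivBy p) e (DivBy-· p x)))))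

  p∣Fₒ : ∀ u → p ∣ₙ Fₒ u
  p∣Fₒ u = ind-∣ (¬? (all? (p ∣?_) u)) (p∣binom-p f p-prime)

  rhsSum≡ : ∀ m ℓ → rhsSum f p m ℓ ≡ (Fₒ ⋆ dilate p (binom G m)) ℓ
  rhsSum≡ m ℓ = begin
    rhsSum f p m ℓ
      ≡⟨ Σ-box ℓ _ ⟩
    sumBox ℓ (λ k → Σ[ box ℓ ] (λ x → term k x))
      ≡⟨ sumBox-cong ℓ (λ k _ → trans (Σ-box ℓ _) (sumBox-cong ℓ (λ x _ → simplify k x))) ⟩
    sumBox ℓ (λ k → sumBox ℓ (λ x → ind ((k ⊕ (p · x)) ≟ᵥ ℓ) (Fₒ k * binom G m x)))
      ≡⟨ sym (⋆-dilate p Fₒ (binom G m) ℓ) ⟩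
    (Fₒ ⋆ dilate p (binom G m)) ℓ ∎
    where
    open ≡-Reasoning
    term : NVec N → NVec N → ℕ
    term k x = ind (¬? (k ≟ᵥ 𝟎)) (ind (¬? (all? (p ∣?_) k))
                 (ind ((k ⊕ (p · x)) ≟ᵥ ℓ) (F k * binom G m x)))
    simplify : ∀ k x → term k x ≡ ind ((k ⊕ (p · x)) ≟ᵥ ℓ) (Fₒ k * binom G m x)
    simplify k x with all? (p ∣?_) k
    ... | yes _ = trans (ind-zero (¬? (k ≟ᵥ 𝟎))) (sym (ind-zero ((k ⊕ (p · x)) ≟ᵥ ℓ)))
    ... | no k∉pℕᴺ =
      ind-yes (¬? (k ≟ᵥ 𝟎)) (λ { refl → k∉pℕᴺ (subst (DivBy p) (·-zeroʳ p) (DivBy-· p 𝟎)) })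

  binom-n*p : ∀ n ℓ →
    binom f (n * p) ℓ ≡ dilate p (binom G n) ℓ + n * rhsSum f p (n ∸ 1) ℓ +multipleOf (p * p)
  binom-n*p n ℓ =
    subst₂ (λ a b → a ≡ b +multipleOf (p * p)) lhs rhs
           (binom-+-firstOrder (dilate p G) Fₒ p∣Fₒ n ℓ)
    where
    lhs : binom (λ v → dilate p G v + Fₒ v) n ℓ ≡ binom f (n * p) ℓ
    lhs = trans (binom-cong (λ v → sym (F-split v)) n ℓ) (binom-* f p n ℓ)
    rhs : binom (dilate p G) n ℓ + n * (Fₒ ⋆ binom (dilate p G) (n ∸ 1)) ℓ ≡
          dilate p (binom G n) ℓ + n * rhsSum f p (n ∸ 1) ℓ
    rhs = cong₂ (λ a b → a + n * b) (binom-dilate p G n ℓ)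
                (trans (⋆-congʳ Fₒ (binom-dilate p G (n ∸ 1)) ℓ) (sym (rhsSum≡ (n ∸ 1) ℓ)))

-- Imported only here: the prefix +_ of ℤ would make sections such as (x +_) ambiguous.
open import Data.Integer using (+_; _-_)
open import Data.Integer.Divisibility using (_∣_)
open import Data.Integer.Properties using ([+m]-[+n]≡m⊖n; ⊖-≥)

+multipleOf⇒∣ : ∀ {a b m} → a ≡ b +multipleOf m → (+ m) ∣ (+ a - + b)
+multipleOf⇒∣ {b = b} {m} (e , m∣e , refl) = subst ((+ m) ∣_) (sym [+[b+e]]-[+b]) m∣e
  where
  [+[b+e]]-[+b] : + (b + e) - + b ≡ + e
  [+[b+e]]-[+b] =
    trans ([+m]-[+n]≡m⊖n (b + e) b) (trans (⊖-≥ (m≤m+n b e)) (cong +_ (m+n∸m≡n b e)))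

theorem10 : (N : ℕ) → 1 ≤ N → (f : NVec N → ℕ) → (p : ℕ) → Prime p → (n : ℕ) →
    (ℓ : NVec N) → (∀ (m : NVec N) → ℓ ≢ p · m) →
    (+ (p * p)) ∣ (+ binom f (n * p) ℓ - + (n * rhsSum f p (n ∸ 1) ℓ))
theorem10 N _ f p p-prime n ℓ ℓ∉pℕᴺ =
  +multipleOf⇒∣ (subst (λ d → binom f (n * p) ℓ ≡ d + n * rhsSum f p (n ∸ 1) ℓ +multipleOf (p * p))
                       (dilate-off p _ (λ m e → ℓ∉pℕᴺ m (sym e)))
                       (binom-n*p f p p-prime n ℓ))
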